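{- Let $G$ be a near double broom on $n$ vertices with diameter $d$, with $\ell$ leaves adjacent to $v_1$ and $r$ leaves adjacent to $v_{d-1}$, where $\ell<r$. Then there exists a double broom $G^*$ on $n$ vertices with diameter $d$ such that $\max_v J_{G^*}(v)<\max_v J_G(v)$.
   Context: For a connected graph $G=(V,E)$ and simple random walk on $G$ (each step moves to a uniformly random neighbor), $H_G(u,v)$ is the expected number of steps for the walk from $u$ to reach $v$, with $H_G(u,u)=0$; the joining time is $J_G(v)=\sum_{u\in V}\deg_G(u)H_G(u,v)$. A double broom of diameter $d$ is a tree consisting of a path $v_1,\ldots,v_{d-1}$ with $\ell\ge1$ leaves adjacent to $v_1$ and $r\ge1$ leaves adjacent to $v_{d-1}$. A near double broom is a tree that is not a double broom but has a leaf $z$ (the singleton leaf) whose removal yields a double broom; as a tree of diameter $d\ge4$ it consists of a path $v_1,\ldots,v_{d-1}$, $\ell$ leaves adjacent to $v_1$, $r$ leaves adjacent to $v_{d-1}$, and the singleton leaf $z$ adjacent to some $v_k$ with $2\le k\le d-2$. -}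

module Defs where

open import Data.Nat using (ℕ; zero; suc; _∸_; _≡ᵇ_; _<ᵇ_; _≤ᵇ_)
import Data.Nat as ℕ
open import Data.Bool using (Bool; true; false; _∧_; _∨_; not; if_then_else_)
open import Data.Fin using (Fin; toℕ)
open import Data.List using (allFin; foldr; map)
open import Data.Product using (_×_)
open import Data.Rational using (ℚ; 0ℚ; 1ℚ; _+_; _*_; _⊔_)
open import Relation.Binary.PropositionalEquality using (_≡_)
open import Relation.Nullary using (¬_)

Adj : ℕ → Set
Adj N = Fin N → Fin N → Bool

Σℚ : ∀ {N} → (Fin N → ℚ) → ℚ
Σℚ {N} f = foldr _+_ 0ℚ (map f (allFin N))

deg : ∀ {N} → Adj N → Fin N → ℚ
deg adj u = Σℚ (λ w → if adj u w then 1ℚ else 0ℚ)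

-- H is the hitting-time function of simple random walk: H u v = expected number of
-- steps from u to reach v. It is characterised by first-step analysis
--   H(v,v) = 0,   H(u,v) = 1 + (1/deg u) Σ_{w ~ u} H(w,v)   (u ≠ v),
-- written here multiplied through by deg u. For a connected graph this linear
-- system has exactly one solution, namely the hitting times.
IsHittingTime : ∀ {N} → Adj N → (Fin N → Fin N → ℚ) → Set
IsHittingTime adj H =
  (∀ v → H v v ≡ 0ℚ) ×
  (∀ u v → ¬ (u ≡ v) →
     deg adj u * H u v ≡ deg adj u + Σℚ (λ w → if adj u w then H w v else 0ℚ))

J : ∀ {N} → Adj N → (Fin N → Fin N → ℚ) → Fin N → ℚ
J adj H v = Σℚ (λ u → deg adj u * H u v)

maxℚ : ∀ {m} → (Fin (suc m) → ℚ) → ℚ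
maxℚ {m} f = foldr _⊔_ (f Fin.zero) (map f (allFin (suc m)))
  where import Data.Fin as Fin

maxJ : ∀ {m} → Adj (suc m) → (Fin (suc m) → Fin (suc m) → ℚ) → ℚ
maxJ adj H = maxℚ (J adj H)

treeAdj : ∀ {N} → (ℕ → ℕ) → Adj N
treeAdj p x y =
  (not (toℕ x ≡ᵇ 0) ∧ (p (toℕ x) ≡ᵇ toℕ y)) ∨
  (not (toℕ y ≡ᵇ 0) ∧ (p (toℕ y) ≡ᵇ toℕ x))

-- Labelling of the double broom of diameter d (d ≥ 2) with ℓ left and r right leaves:
--   labels 0 .. d-2           : path v_1 .. v_{d-1}   (label t is v_{t+1})
--   labels d-1 .. d-2+ℓ       : the ℓ leaves adjacent to v_1
--   labels d-1+ℓ .. d-2+ℓ+r   : the r leaves adjacent to v_{d-1}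
dbParent : ℕ → ℕ → ℕ → ℕ → ℕ
dbParent d ℓ r i =
  if i ≤ᵇ d ∸ 2 then i ∸ 1
  else if i <ᵇ (d ∸ 1) ℕ.+ ℓ then 0
  else d ∸ 2

dbSize : ℕ → ℕ → ℕ → ℕ
dbSize d ℓ r = suc ((d ∸ 2) ℕ.+ ℓ ℕ.+ r)

dbAdj : (d ℓ r : ℕ) → Adj (dbSize d ℓ r)
dbAdj d ℓ r = treeAdj (dbParent d ℓ r)

-- Near double broom: the double broom above plus the singleton leaf z, with
-- label d-1+ℓ+r, adjacent to v_k (label k-1).
ndbParent : ℕ → ℕ → ℕ → ℕ → ℕ → ℕ
ndbParent d ℓ r k i =
  if i ≡ᵇ (d ∸ 1) ℕ.+ ℓ ℕ.+ r then k ∸ 1 else dbParent d ℓ r i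

ndbSize : ℕ → ℕ → ℕ → ℕ
ndbSize d ℓ r = suc ((d ∸ 2) ℕ.+ ℓ ℕ.+ r ℕ.+ 1)

ndbAdj : (d ℓ r k : ℕ) → Adj (ndbSize d ℓ r)
ndbAdj d ℓ r k = treeAdj (ndbParent d ℓ r k)

{-# OPTIONS --safe #-}
module Submission where

-- On a tree, first-step analysis turns the joining time into a sum over edges,
-- J(v) = Σ_e (∇_e H(·,v))², and testing the first-step equations against the indicator of one
-- side of an edge e shows that the gradient across e is, up to sign, the total degree 2m + 1 of
-- the side of e not containing v, where m counts the edges on that side. Hence
-- J(v) = Σ_e (2 m_e(v) + 1)².
-- Moving the singleton leaf to v₁ gives a double broom with ℓ + 1 ≤ r end leaves. There J is
-- largest at a leaf u at v₁, from which every path edge sees the right part of the path as its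
-- far side; ℓ + 1 ≤ r is what makes this beat the other vertices. At the same leaf u of the near
-- double broom every edge term is at least as large, and the first path edge, which has the
-- singleton leaf on its far side because k ≥ 2, contributes strictly more.

open import Defs
open import Data.Nat using (ℕ; _≤_; _∸_)
import Data.Nat as ℕ
open import Data.Product using (Σ-syntax; _×_)
open import Data.Rational using (_<_)
open import Relation.Binary.PropositionalEquality using (_≡_)

open import Algebra.Bundles using (CommutativeMonoid; CommutativeRing)
open import Data.Bool using (Bool; true; false; not; _∧_; _∨_; if_then_else_; T)
open import Data.Empty using (⊥; ⊥-elim)
open import Data.Fin as Fin using (Fin; toℕ)
import Data.Fin.Properties as Finₚ
open import Data.Fin.Permutation using (reverse)
open import Data.List using (map; allFin; foldr; tabulate)
import Data.List.Properties as Listₚ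
import Data.List.Relation.Unary.All.Properties as Allₚ
import Data.List.Relation.Unary.Any as Any
open import Data.List.Membership.Propositional.Properties using (∈-map⁺; ∈-allFin)
open import Data.Nat using (zero; suc; z≤n; s≤s; _≡ᵇ_; _<ᵇ_; _≤ᵇ_)
import Data.Nat.Properties as ℕₚ
import Data.Bool.Properties as Boolₚ
open import Data.Product using (_,_; proj₁; proj₂)
import Data.Rational as ℚ
open import Data.Rational using (ℚ; 0ℚ; 1ℚ; _+_; _*_; _-_; _⊔_)
import Data.Rational.Properties as ℚₚ
open import Data.Sum using (inj₂; [_,_])
open import Function using (_∘_; const; id)
open import Relation.Binary.PropositionalEquality
  using (_≢_; refl; sym; trans; cong; cong₂; subst; module ≡-Reasoning)
open import Relation.Nullary using (¬_; yes; no)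
open import Relation.Nullary.Decidable using (dec⇒maybe)
open import Relation.Nullary.Reflects using (Reflects; ofʸ; ofⁿ; fromEquivalence)
open import Tactic.RingSolver using (solve-∀)
open import Tactic.RingSolver.Core.AlmostCommutativeRing
  using (AlmostCommutativeRing; fromCommutativeRing)
import Data.Nat.Tactic.RingSolver as ℕ-Solver

open import Algebra.Properties.Group ℚₚ.+-0-group using () renaming (∙-cancelʳ to +-cancelʳ)

ℚ-ring : AlmostCommutativeRing _ _
ℚ-ring = fromCommutativeRing ℚₚ.+-*-commutativeRing (λ x → dec⇒maybe (0ℚ ℚₚ.≟ x))

reflects-true : ∀ {a} {A : Set a} {b} → Reflects A b → A → b ≡ true
reflects-true (ofʸ _)  _ = refl
reflects-true (ofⁿ ¬a) a = ⊥-elim (¬a a)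

reflects-false : ∀ {a} {A : Set a} {b} → Reflects A b → ¬ A → b ≡ false
reflects-false (ofʸ a) ¬a = ⊥-elim (¬a a)
reflects-false (ofⁿ _) _  = refl

≡ᵇ-reflects-≡ : ∀ m n → Reflects (m ≡ n) (m ≡ᵇ n)
≡ᵇ-reflects-≡ m n = fromEquivalence (ℕₚ.≡ᵇ⇒≡ m n) (ℕₚ.≡⇒≡ᵇ m n)

≡ᵇ⇒≡ : ∀ {m n} → (m ≡ᵇ n) ≡ true → m ≡ n
≡ᵇ⇒≡ m≡ᵇn = ℕₚ.≡ᵇ⇒≡ _ _ (subst T (sym m≡ᵇn) _)

≡ᵇ-true : ∀ {m n} → m ≡ n → (m ≡ᵇ n) ≡ true
≡ᵇ-true = reflects-true (≡ᵇ-reflects-≡ _ _)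

≡ᵇ-false : ∀ {m n} → m ≢ n → (m ≡ᵇ n) ≡ false
≡ᵇ-false = reflects-false (≡ᵇ-reflects-≡ _ _)

<ᵇ-true : ∀ {m n} → m ℕ.< n → (m <ᵇ n) ≡ true
<ᵇ-true = reflects-true (ℕₚ.<ᵇ-reflects-< _ _)

<ᵇ-false : ∀ {m n} → n ≤ m → (m <ᵇ n) ≡ false
<ᵇ-false n≤m = reflects-false (ℕₚ.<ᵇ-reflects-< _ _) (ℕₚ.≤⇒≯ n≤m)

≤ᵇ-true : ∀ {m n} → m ≤ n → (m ≤ᵇ n) ≡ true
≤ᵇ-true = reflects-true (ℕₚ.≤ᵇ-reflects-≤ _ _)

≤ᵇ-false : ∀ {m n} → n ℕ.< m → (m ≤ᵇ n) ≡ false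
≤ᵇ-false n<m = reflects-false (ℕₚ.≤ᵇ-reflects-≤ _ _) (ℕₚ.<⇒≱ n<m)

module FiniteSum {c ℓ} (M : CommutativeMonoid c ℓ) where

  open CommutativeMonoid M
    renaming (_∙_ to _⊕_; ε to 𝟘; ∙-congˡ to ⊕-congˡ; sym to ≈-sym; trans to ≈-trans)
    hiding (refl)
  open import Algebra.Properties.CommutativeMonoid.Sum M
    using (sum; sum-cong-≋; sum-cong-≗; sum-replicate-zero; ∑-distrib-+; ∑-comm; ∑-permute)
  open import Relation.Binary.Reasoning.Setoid setoid

  ∑ : ℕ → (ℕ → Carrier) → Carrier
  ∑ n f = sum {n} (f ∘ toℕ)

  syntax ∑ n (λ i → x) = ∑[ i < n ] x

  ∑-cong : ∀ n {f g : ℕ → Carrier} → (∀ {i} → i ℕ.< n → f i ≈ g i) → ∑ n f ≈ ∑ n g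
  ∑-cong n f≈g = sum-cong-≋ {n} (λ i → f≈g (Finₚ.toℕ<n i))

  ∑-zero : ∀ n → ∑[ i < n ] 𝟘 ≈ 𝟘
  ∑-zero = sum-replicate-zero

  ∑-distrib-⊕ : ∀ n (f g : ℕ → Carrier) → ∑[ i < n ] (f i ⊕ g i) ≈ ∑ n f ⊕ ∑ n g
  ∑-distrib-⊕ n f g = ∑-distrib-+ {n} (f ∘ toℕ) (g ∘ toℕ)

  ∑-swap : ∀ m n (F : ℕ → ℕ → Carrier) → ∑[ i < m ] ∑[ j < n ] F i j ≈ ∑[ j < n ] ∑[ i < m ] F i j
  ∑-swap m n F = ∑-comm {m} {n} (λ i j → F (toℕ i) (toℕ j))

  ∑-++ : ∀ m n (f : ℕ → Carrier) → ∑ (m ℕ.+ n) f ≈ ∑ m f ⊕ ∑[ i < n ] f (m ℕ.+ i)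
  ∑-++ zero    n f = ≈-sym (identityˡ _)
  ∑-++ (suc m) n f = ≈-trans (⊕-congˡ (∑-++ m n (f ∘ suc))) (≈-sym (assoc _ _ _))

  ∑-split : ∀ {m n} → m ≤ n → (f : ℕ → Carrier) → ∑ n f ≈ ∑ m f ⊕ ∑[ i < n ∸ m ] f (m ℕ.+ i)
  ∑-split {m} {n} m≤n f =
    ≈-trans (reflexive (cong (λ k → ∑ k f) (sym (ℕₚ.m+[n∸m]≡n m≤n)))) (∑-++ m (n ∸ m) f)

  ∑-δ : ∀ {n a} → a ℕ.< n → (f : ℕ → Carrier) → ∑[ i < n ] (if a ≡ᵇ i then f i else 𝟘) ≈ f a
  ∑-δ {suc n} {zero}  _         f = ≈-trans (⊕-congˡ (∑-zero n)) (identityʳ _)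
  ∑-δ {suc n} {suc a} (s≤s a<n) f = ≈-trans (identityˡ _) (∑-δ a<n (f ∘ suc))

  ∑-reverse : ∀ n (f : ℕ → Carrier) → ∑[ i < n ] f (n ∸ suc i) ≈ ∑ n f
  ∑-reverse n f = begin
    ∑[ i < n ] f (n ∸ suc i)                  ≡⟨ sum-cong-≗ {n} (λ i → cong f (sym (Finₚ.opposite-prop i))) ⟩
    sum {n} (λ i → f (toℕ (Fin.opposite i))) ≈⟨ ≈-sym (∑-permute (f ∘ toℕ) (reverse {n})) ⟩
    ∑ n f                                     ∎

module ℕ-Sum where
  open FiniteSum ℕₚ.+-0-commutativeMonoid public

  ∑-mono-≤ : ∀ n {f g : ℕ → ℕ} → (∀ {i} → i ℕ.< n → f i ≤ g i) → ∑ n f ≤ ∑ n g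
  ∑-mono-≤ zero    _   = z≤n
  ∑-mono-≤ (suc n) f≤g = ℕₚ.+-mono-≤ (f≤g (s≤s z≤n)) (∑-mono-≤ n (f≤g ∘ s≤s))

  ∑-mono-< : ∀ n {f g : ℕ → ℕ} → (∀ {i} → i ℕ.< n → f i ≤ g i) → 0 ℕ.< n → f 0 ℕ.< g 0 →
             ∑ n f ℕ.< ∑ n g
  ∑-mono-< (suc n) f≤g _ f0<g0 = ℕₚ.+-mono-<-≤ f0<g0 (∑-mono-≤ n (f≤g ∘ s≤s))

  ∑-count : ∀ n a → ∑[ j < n ] (if a <ᵇ suc j then 1 else 0) ≡ n ∸ a
  ∑-count zero    zero    = refl
  ∑-count zero    (suc a) = refl
  ∑-count (suc n) zero    = cong suc (∑-count n zero)
  ∑-count (suc n) (suc a) = ∑-count n a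

  ∑-const : ∀ n c → ∑[ i < n ] c ≡ n ℕ.* c
  ∑-const zero    c = refl
  ∑-const (suc n) c = cong (c ℕ.+_) (∑-const n c)

  private
    spike : ℕ → ℕ → ℕ → ℕ → ℕ
    spike b v y i = if b ℕ.+ i ≡ᵇ v then suc y else 1

    ∑-spike-shift : ∀ n b v y → ∑[ i < n ] spike b v y (suc i) ≡ ∑ n (spike (suc b) v y)
    ∑-spike-shift n b v y = ∑-cong n (λ {i} _ → cong (λ k → if k ≡ᵇ v then suc y else 1) (ℕₚ.+-suc b i))

    ∑-spike-below : ∀ n b v y → v ℕ.< b → ∑ n (spike b v y) ≡ n
    ∑-spike-below n b v y v<b = trans
      (∑-cong n (λ {i} _ → cong (if_then suc y else 1)
        (≡ᵇ-false (λ b+i≡v → ℕₚ.<⇒≱ v<b (ℕₚ.≤-trans (ℕₚ.m≤m+n b i) (ℕₚ.≤-reflexive b+i≡v))))))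
      (trans (∑-const n 1) (ℕₚ.*-identityʳ n))

  ∑-spike-at : ∀ n {b v} y → 0 ℕ.< n → b ≡ v → ∑[ i < n ] (if b ℕ.+ i ≡ᵇ v then suc y else 1) ≡ y ℕ.+ n
  ∑-spike-at (suc n) {b} y _ refl = begin
    spike b b y 0 ℕ.+ ∑ n (λ i → spike b b y (suc i))
      ≡⟨ cong₂ ℕ._+_ (cong (if_then suc y else 1) (≡ᵇ-true (ℕₚ.+-identityʳ b))) (∑-spike-shift n b b y) ⟩
    suc y ℕ.+ ∑ n (spike (suc b) b y)
      ≡⟨ cong (suc y ℕ.+_) (∑-spike-below n (suc b) b y ℕₚ.≤-refl) ⟩
    suc y ℕ.+ n
      ≡⟨ sym (ℕₚ.+-suc y n) ⟩
    y ℕ.+ suc n ∎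
    where open ≡-Reasoning

  ∑-spike-≤ : ∀ n b v y → ∑[ i < n ] (if b ℕ.+ i ≡ᵇ v then suc y else 1) ≤ y ℕ.+ n
  ∑-spike-≤ zero    b v y = z≤n
  ∑-spike-≤ (suc n) b v y with b ℕ.≟ v
  ... | yes b≡v = ℕₚ.≤-reflexive (∑-spike-at (suc n) y (s≤s z≤n) b≡v)
  ... | no b≢v = begin
    spike b v y 0 ℕ.+ ∑ n (λ i → spike b v y (suc i))
      ≡⟨ cong₂ ℕ._+_ (cong (if_then suc y else 1) (≡ᵇ-false (b≢v ∘ trans (sym (ℕₚ.+-identityʳ b)))))
                     (∑-spike-shift n b v y) ⟩
    suc (∑ n (spike (suc b) v y))
      ≤⟨ s≤s (∑-spike-≤ n (suc b) v y) ⟩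
    suc (y ℕ.+ n)
      ≡⟨ sym (ℕₚ.+-suc y n) ⟩
    y ℕ.+ suc n ∎
    where open ℕₚ.≤-Reasoning

module ℚ-Sum where
  open FiniteSum ℚₚ.+-0-commutativeMonoid public
  open import Algebra.Properties.Semiring.Sum (CommutativeRing.semiring ℚₚ.+-*-commutativeRing)
    using (*-distribˡ-sum)

  ∑-distribˡ-* : ∀ n c (f : ℕ → ℚ) → c * ∑ n f ≡ ∑[ i < n ] (c * f i)
  ∑-distribˡ-* n c f = *-distribˡ-sum {n} c (f ∘ toℕ)
import Algebra.Properties.Monoid.Mult ℚₚ.+-0-monoid as ℚ-Mult
open import Algebra.Properties.Semiring.Mult (CommutativeRing.semiring ℚₚ.+-*-commutativeRing) using (×1-homo-*)

fromℕ : ℕ → ℚ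
fromℕ n = n ℚ-Mult.× 1ℚ

fromℕ-+ : ∀ m n → fromℕ (m ℕ.+ n) ≡ fromℕ m + fromℕ n
fromℕ-+ = ℚ-Mult.×-homo-+ 1ℚ

fromℕ-* : ∀ m n → fromℕ (m ℕ.* n) ≡ fromℕ m * fromℕ n
fromℕ-* = ×1-homo-*

fromℕ-∑ : ∀ n (f : ℕ → ℕ) → fromℕ (ℕ-Sum.∑ n f) ≡ ℚ-Sum.∑ n (fromℕ ∘ f)
fromℕ-∑ zero    f = refl
fromℕ-∑ (suc n) f = trans (fromℕ-+ (f 0) _) (cong (fromℕ (f 0) +_) (fromℕ-∑ n (f ∘ suc)))

fromℕ-<-suc : ∀ n → fromℕ n ℚ.< fromℕ (suc n)
fromℕ-<-suc n = subst (ℚ._< 1ℚ + fromℕ n) (ℚₚ.+-identityˡ (fromℕ n))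
                      (ℚₚ.+-monoˡ-< (fromℕ n) (ℚₚ.positive⁻¹ 1ℚ))

fromℕ-mono-≤ : ∀ {m n} → m ≤ n → fromℕ m ℚ.≤ fromℕ n
fromℕ-mono-≤ m≤n = go (ℕₚ.≤⇒≤′ m≤n)
  where
  go : ∀ {m n} → m ℕ.≤′ n → fromℕ m ℚ.≤ fromℕ n
  go ℕ.≤′-refl            = ℚₚ.≤-refl
  go (ℕ.≤′-step {n} m≤′n) = ℚₚ.≤-trans (go m≤′n) (ℚₚ.<⇒≤ (fromℕ-<-suc n))

fromℕ-mono-< : ∀ {m n} → m ℕ.< n → fromℕ m ℚ.< fromℕ n
fromℕ-mono-< {m} m<n = ℚₚ.<-≤-trans (fromℕ-<-suc m) (fromℕ-mono-≤ m<n)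

maxℚ-upper : ∀ {m} (f : Fin (suc m) → ℚ) x → f x ℚ.≤ maxℚ f
maxℚ-upper f x = Listₚ.foldr-preservesᵒ
  (λ a b → [ (λ fx≤a → ℚₚ.≤-trans fx≤a (ℚₚ.p≤p⊔q a b)) , (λ fx≤b → ℚₚ.≤-trans fx≤b (ℚₚ.p≤q⊔p a b)) ])
  (f Fin.zero) (map f (allFin _)) (inj₂ (Any.map ℚₚ.≤-reflexive (∈-map⁺ f (∈-allFin x))))

maxℚ-least : ∀ {m} (f : Fin (suc m) → ℚ) {B} → (∀ x → f x ℚ.≤ B) → maxℚ f ℚ.≤ B
maxℚ-least f {B} f≤B = Listₚ.foldr-preservesᵇ {P = ℚ._≤ B} {f = _⊔_} ℚₚ.⊔-lub (f≤B Fin.zero)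
  (Allₚ.map⁺ {f = f} (Allₚ.tabulate⁺ {f = id} f≤B))

Σℚ≡∑ : ∀ {n} (f : Fin n → ℚ) (g : ℕ → ℚ) → (∀ x → f x ≡ g (toℕ x)) → Σℚ f ≡ ℚ-Sum.∑ n g
Σℚ≡∑ {n} f g f≗g = trans (cong (foldr _+_ 0ℚ) (Listₚ.map-tabulate id f)) (go n f g f≗g)
  where
  go : ∀ n (f : Fin n → ℚ) (g : ℕ → ℚ) → (∀ x → f x ≡ g (toℕ x)) → foldr _+_ 0ℚ (tabulate f) ≡ ℚ-Sum.∑ n g
  go zero    f g f≗g = refl
  go (suc n) f g f≗g = cong₂ _+_ (f≗g Fin.zero) (go n (f ∘ Fin.suc) (g ∘ suc) (f≗g ∘ Fin.suc))

∑-fromℕ-const : ∀ n c → ℚ-Sum.∑ n (λ _ → fromℕ c) ≡ fromℕ (n ℕ.* c)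
∑-fromℕ-const n c = trans (sym (fromℕ-∑ n (const c))) (cong fromℕ (ℕ-Sum.∑-const n c))

-- The junk value outside 0 … n − 1 is 0.
lift : ∀ {n} → (Fin n → ℚ) → ℕ → ℚ
lift {n} f i with i ℕ.<? n
... | yes i<n = f (Fin.fromℕ< i<n)
... | no _    = 0ℚ

lift-toℕ : ∀ {n} (f : Fin n → ℚ) x → lift f (toℕ x) ≡ f x
lift-toℕ {n} f x with toℕ x ℕ.<? n
... | yes x<n = cong f (Finₚ.fromℕ<-toℕ x x<n)
... | no x≮n  = ⊥-elim (x≮n (Finₚ.toℕ<n x))

if-∨ : ∀ b c (x : ℚ) → (b ≡ true → c ≡ true → ⊥) →
       (if b ∨ c then x else 0ℚ) ≡ (if b then x else 0ℚ) + (if c then x else 0ℚ)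
if-∨ true  true  x b↯c = ⊥-elim (b↯c refl refl)
if-∨ true  false x _   = sym (ℚₚ.+-identityʳ x)
if-∨ false c     x _   = sym (ℚₚ.+-identityˡ _)

*-if : ∀ b (c x : ℚ) → c * (if b then x else 0ℚ) ≡ (if b then c * x else 0ℚ)
*-if true  c x = refl
*-if false c x = ℚₚ.*-zeroʳ c

if-* : ∀ b (x : ℚ) → (if b then 1ℚ else 0ℚ) * x ≡ (if b then x else 0ℚ)
if-* true  x = ℚₚ.*-identityˡ x
if-* false x = ℚₚ.*-zeroˡ x

fromℕ-if : ∀ b → fromℕ (if b then 1 else 0) ≡ (if b then 1ℚ else 0ℚ)
fromℕ-if true  = ℚₚ.+-identityʳ 1ℚ
fromℕ-if false = refl

square-of-neg : ∀ {x v w : ℚ} → x + (v + w) ≡ v → x * x ≡ w * w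
square-of-neg {x} {v} {w} x+v+w≡v = begin
  x * x                           ≡⟨ cong₂ _*_ x≡ x≡ ⟩
  (v - (v + w)) * (v - (v + w))   ≡⟨ neg-square v w ⟩
  w * w                           ∎
  where
  neg-square : ∀ a b → (a - (a + b)) * (a - (a + b)) ≡ b * b
  neg-square = solve-∀ ℚ-ring
  add-sub : ∀ a b → a ≡ (a + b) - b
  add-sub = solve-∀ ℚ-ring
  x≡ : x ≡ v - (v + w)
  x≡ = trans (add-sub x (v + w)) (cong (_- (v + w)) x+v+w≡v)
  open ≡-Reasoning

-- (2m + 1)²: the squared hitting-time gradient across an edge with m edges on its far side.
odd² : ℕ → ℕ
odd² m = suc (2 ℕ.* m) ℕ.* suc (2 ℕ.* m)

-- Hitting times on trees

-- Vertices are the labels 0 … M with root 0; edge j joins suc j to its parent p (suc j).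
module Tree (M : ℕ) (p : ℕ → ℕ) (parent≤ : ∀ {j} → j ℕ.< M → p (suc j) ≤ j) where

  open ℚ-Sum
  open ≡-Reasoning

  N : ℕ
  N = suc M

  hasParent : ℕ → ℕ → Bool
  hasParent u w = not (u ≡ᵇ 0) ∧ (p u ≡ᵇ w)

  adj : ℕ → ℕ → Bool
  adj u w = hasParent u w ∨ hasParent w u

  nbSum : (ℕ → ℚ) → ℕ → ℚ
  nbSum f u = ∑ N (λ w → if adj u w then f w else 0ℚ)

  degree : ℕ → ℚ
  degree = nbSum (const 1ℚ)

  record HittingEqs (h : ℕ → ℚ) (v : ℕ) : Set where
    field
      at-target  : h v ≡ 0ℚ
      first-step : ∀ {u} → u ℕ.< N → u ≢ v → degree u * h u ≡ degree u + nbSum h u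

  ∇ : (ℕ → ℚ) → ℕ → ℚ
  ∇ f j = f (suc j) - f (p (suc j))

  parent<N : ∀ {j} → j ℕ.< M → p (suc j) ℕ.< N
  parent<N j<M = s≤s (ℕₚ.≤-trans (parent≤ j<M) (ℕₚ.<⇒≤ j<M))

  hasParent-asym : ∀ {u w} → u ℕ.< N → w ℕ.< N → hasParent u w ≡ true → hasParent w u ≡ true → ⊥
  hasParent-asym {suc a} {suc b} (s≤s a<M) (s≤s b<M) pa≡b pb≡a = ℕₚ.<-asym
    (ℕₚ.≤-trans (ℕₚ.≤-reflexive (sym (≡ᵇ⇒≡ pa≡b))) (parent≤ a<M))
    (ℕₚ.≤-trans (ℕₚ.≤-reflexive (sym (≡ᵇ⇒≡ pb≡a))) (parent≤ b<M))

  ∑∑-hasParent : ∀ (F : ℕ → ℕ → ℚ) →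
    ∑ N (λ u → ∑ N (λ w → if hasParent u w then F u w else 0ℚ)) ≡ ∑ M (λ j → F (suc j) (p (suc j)))
  ∑∑-hasParent F = begin
    ∑ N (λ w → 0ℚ) + ∑ M (λ j → ∑ N (λ w → if p (suc j) ≡ᵇ w then F (suc j) w else 0ℚ))
      ≡⟨ cong₂ _+_ (∑-zero N) (∑-cong M (λ {j} j<M → ∑-δ (parent<N j<M) (F (suc j)))) ⟩
    0ℚ + ∑ M (λ j → F (suc j) (p (suc j)))
      ≡⟨ ℚₚ.+-identityˡ _ ⟩
    ∑ M (λ j → F (suc j) (p (suc j))) ∎

  ∑-nbSum : ∀ (c f : ℕ → ℚ) → ∑ N (λ u → c u * nbSum f u) ≡
            ∑ M (λ j → c (suc j) * f (p (suc j)) + c (p (suc j)) * f (suc j))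
  ∑-nbSum c f = begin
    ∑ N (λ u → c u * nbSum f u)
      ≡⟨ ∑-cong N (λ {u} u<N → trans (∑-distribˡ-* N (c u) (λ w → if adj u w then f w else 0ℚ))
                                      (∑-cong N (split u<N))) ⟩
    ∑ N (λ u → ∑ N (λ w → up u w + down u w))
      ≡⟨ ∑-cong N (λ {u} _ → ∑-distrib-⊕ N (up u) (down u)) ⟩
    ∑ N (λ u → ∑ N (up u) + ∑ N (down u))
      ≡⟨ ∑-distrib-⊕ N (λ u → ∑ N (up u)) (λ u → ∑ N (down u)) ⟩
    ∑ N (λ u → ∑ N (up u)) + ∑ N (λ u → ∑ N (down u))
      ≡⟨ cong₂ _+_ (∑∑-hasParent (λ u w → c u * f w))
                   (trans (∑-swap N N down) (∑∑-hasParent (λ w u → c u * f w))) ⟩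
    ∑ M (λ j → c (suc j) * f (p (suc j))) + ∑ M (λ j → c (p (suc j)) * f (suc j))
      ≡⟨ sym (∑-distrib-⊕ M (λ j → c (suc j) * f (p (suc j))) (λ j → c (p (suc j)) * f (suc j))) ⟩
    ∑ M (λ j → c (suc j) * f (p (suc j)) + c (p (suc j)) * f (suc j)) ∎
    where
    up down : ℕ → ℕ → ℚ
    up   u w = if hasParent u w then c u * f w else 0ℚ
    down u w = if hasParent w u then c u * f w else 0ℚ
    split : ∀ {u w} → u ℕ.< N → w ℕ.< N → c u * (if adj u w then f w else 0ℚ) ≡ up u w + down u w
    split {u} {w} u<N w<N = trans (*-if (adj u w) (c u) (f w))
      (if-∨ (hasParent u w) (hasParent w u) (c u * f w) (hasParent-asym u<N w<N))

  ∑-degree : ∀ (c : ℕ → ℚ) → ∑ N (λ u → c u * degree u) ≡ ∑ M (λ j → c (suc j) + c (p (suc j)))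
  ∑-degree c = trans (∑-nbSum c (const 1ℚ))
    (∑-cong M (λ {j} _ → cong₂ _+_ (ℚₚ.*-identityʳ (c (suc j))) (ℚₚ.*-identityʳ (c (p (suc j))))))

  -- Up to an additive constant, χ is the indicator of the side of edge x away from the root.
  record IsCut (x : ℕ) (χ : ℕ → ℕ) : Set where
    constructor isCut
    field
      jump : ∀ {j} → j ℕ.< M → χ (suc j) ≡ (if x ≡ᵇ j then 1 else 0) ℕ.+ χ (p (suc j))

  volume : (ℕ → ℕ) → ℕ
  volume χ = ℕ-Sum.∑ M (λ j → χ (suc j) ℕ.+ χ (p (suc j)))

  volume-cut : ∀ {x χ m} → IsCut x χ → x ℕ.< M → ℕ-Sum.∑ M (χ ∘ suc) ≡ suc m → volume χ ≡ suc (2 ℕ.* m)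
  volume-cut {x} {χ} {m} cut x<M size = begin
    volume χ            ≡⟨ ℕ-Sum.∑-distrib-⊕ M (χ ∘ suc) (χ ∘ p ∘ suc) ⟩
    S ℕ.+ P             ≡⟨ cong₂ ℕ._+_ size P≡m ⟩
    suc m ℕ.+ m         ≡⟨ cong suc (cong (m ℕ.+_) (sym (ℕₚ.+-identityʳ m))) ⟩
    suc (2 ℕ.* m)       ∎
    where
    S P : ℕ
    S = ℕ-Sum.∑ M (χ ∘ suc)
    P = ℕ-Sum.∑ M (χ ∘ p ∘ suc)
    S≡1+P : S ≡ suc P
    S≡1+P = begin
      S
        ≡⟨ ℕ-Sum.∑-cong M (IsCut.jump cut) ⟩
      ℕ-Sum.∑ M (λ j → (if x ≡ᵇ j then 1 else 0) ℕ.+ χ (p (suc j)))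
        ≡⟨ ℕ-Sum.∑-distrib-⊕ M (λ j → if x ≡ᵇ j then 1 else 0) (χ ∘ p ∘ suc) ⟩
      ℕ-Sum.∑ M (λ j → if x ≡ᵇ j then 1 else 0) ℕ.+ P
        ≡⟨ cong (ℕ._+ P) (ℕ-Sum.∑-δ x<M (const 1)) ⟩
      suc P ∎
    P≡m : P ≡ m
    P≡m = ℕₚ.suc-injective (trans (sym S≡1+P) size)

  ∑-fromℕ-volume : ∀ χ → ∑ M (λ j → fromℕ (χ (suc j)) + fromℕ (χ (p (suc j)))) ≡ fromℕ (volume χ)
  ∑-fromℕ-volume χ = begin
    ∑ M (λ j → fromℕ (χ (suc j)) + fromℕ (χ (p (suc j))))
      ≡⟨ ∑-cong M (λ {j} _ → sym (fromℕ-+ (χ (suc j)) (χ (p (suc j))))) ⟩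
    ∑ M (λ j → fromℕ (χ (suc j) ℕ.+ χ (p (suc j))))
      ≡⟨ sym (fromℕ-∑ M (λ j → χ (suc j) ℕ.+ χ (p (suc j)))) ⟩
    fromℕ (volume χ) ∎

  ∇-fromℕ-cut : ∀ {x χ} → IsCut x χ → ∀ {j} → j ℕ.< M → ∇ (fromℕ ∘ χ) j ≡ (if x ≡ᵇ j then 1ℚ else 0ℚ)
  ∇-fromℕ-cut {x} {χ} cut {j} j<M = begin
    fromℕ (χ (suc j)) - fromℕ (χ (p (suc j)))
      ≡⟨ cong (λ n → fromℕ n - fromℕ (χ (p (suc j)))) (IsCut.jump cut j<M) ⟩
    fromℕ (δ ℕ.+ χ (p (suc j))) - fromℕ (χ (p (suc j)))
      ≡⟨ cong (_- fromℕ (χ (p (suc j)))) (fromℕ-+ δ (χ (p (suc j)))) ⟩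
    (fromℕ δ + fromℕ (χ (p (suc j)))) - fromℕ (χ (p (suc j)))
      ≡⟨ add-sub (fromℕ δ) (fromℕ (χ (p (suc j)))) ⟩
    fromℕ δ
      ≡⟨ fromℕ-if (x ≡ᵇ j) ⟩
    (if x ≡ᵇ j then 1ℚ else 0ℚ) ∎
    where
    δ : ℕ
    δ = if x ≡ᵇ j then 1 else 0
    add-sub : ∀ a b → (a + b) - b ≡ a
    add-sub = solve-∀ ℚ-ring

  IsLeaf : ℕ → Set
  IsLeaf y = ∀ {j} → j ℕ.< M → p (suc j) ≢ y

  leafCut : ℕ → ℕ → ℕ
  leafCut y i = if suc y ≡ᵇ i then 1 else 0

  leafCut-isCut : ∀ {y} → IsLeaf (suc y) → IsCut y (leafCut y)
  leafCut-isCut {y} leaf = isCut jump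
    where
    jump : ∀ {j} → j ℕ.< M → leafCut y (suc j) ≡ (if y ≡ᵇ j then 1 else 0) ℕ.+ leafCut y (p (suc j))
    jump {j} j<M rewrite ≡ᵇ-false (leaf j<M ∘ sym) = sym (ℕₚ.+-identityʳ _)

  leafCut-size : ∀ {y} → y ℕ.< M → ℕ-Sum.∑ M (leafCut y ∘ suc) ≡ 1
  leafCut-size y<M = ℕ-Sum.∑-δ y<M (const 1)

  module Hitting {h : ℕ → ℚ} {v : ℕ} (eqs : HittingEqs h v) where

    open HittingEqs eqs

    private
      weighted-first-step : ∀ (χ : ℕ → ℚ) → χ v ≡ 0ℚ → ∀ {u} → u ℕ.< N →
                 (χ u * h u) * degree u ≡ χ u * degree u + χ u * nbSum h u
      weighted-first-step χ χv {u} u<N with u ℕ.≟ v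
      ... | yes refl rewrite χv = zero-weight (h u) (degree u) (nbSum h u)
        where
        zero-weight : ∀ a b c → (0ℚ * a) * b ≡ 0ℚ * b + 0ℚ * c
        zero-weight = solve-∀ ℚ-ring
      ... | no u≢v = begin
        (χ u * h u) * degree u           ≡⟨ ℚₚ.*-assoc (χ u) (h u) (degree u) ⟩
        χ u * (h u * degree u)           ≡⟨ cong (χ u *_) (ℚₚ.*-comm (h u) (degree u)) ⟩
        χ u * (degree u * h u)           ≡⟨ cong (χ u *_) (first-step u<N u≢v) ⟩
        χ u * (degree u + nbSum h u)     ≡⟨ ℚₚ.*-distribˡ-+ (χ u) (degree u) (nbSum h u) ⟩
        χ u * degree u + χ u * nbSum h u ∎

    -- Summation by parts over the edges; χ v = 0 discards the one vertex without a first-step equation.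
    green-identity : ∀ (χ : ℕ → ℚ) → χ v ≡ 0ℚ →
            ∑ M (λ j → ∇ χ j * ∇ h j) ≡ ∑ M (λ j → χ (suc j) + χ (p (suc j)))
    green-identity χ χv = +-cancelʳ cross (∑ M (λ j → ∇ χ j * ∇ h j)) (∑ M (λ j → χ (suc j) + χ (p (suc j)))) (begin
      ∑ M (λ j → ∇ χ j * ∇ h j) + cross
        ≡⟨ sym (∑-distrib-⊕ M (λ j → ∇ χ j * ∇ h j) cross-term) ⟩
      ∑ M (λ j → ∇ χ j * ∇ h j + cross-term j)
        ≡⟨ ∑-cong M (λ {j} _ → ∇∇+cross (χ (suc j)) (χ (p (suc j))) (h (suc j)) (h (p (suc j)))) ⟩
      ∑ M (λ j → χ (suc j) * h (suc j) + χ (p (suc j)) * h (p (suc j)))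
        ≡⟨ sym (∑-degree (λ u → χ u * h u)) ⟩
      ∑ N (λ u → (χ u * h u) * degree u)
        ≡⟨ ∑-cong N (weighted-first-step χ χv) ⟩
      ∑ N (λ u → χ u * degree u + χ u * nbSum h u)
        ≡⟨ ∑-distrib-⊕ N (λ u → χ u * degree u) (λ u → χ u * nbSum h u) ⟩
      ∑ N (λ u → χ u * degree u) + ∑ N (λ u → χ u * nbSum h u)
        ≡⟨ cong₂ _+_ (∑-degree χ) (∑-nbSum χ h) ⟩
      ∑ M (λ j → χ (suc j) + χ (p (suc j))) + cross ∎)
      where
      cross-term : ℕ → ℚ
      cross-term j = χ (suc j) * h (p (suc j)) + χ (p (suc j)) * h (suc j)
      cross : ℚ
      cross = ∑ M cross-term
      ∇∇+cross : ∀ a b x y → (a - b) * (x - y) + (a * y + b * x) ≡ a * x + b * y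
      ∇∇+cross = solve-∀ ℚ-ring

    ∑-degree-h≡∑-∇² : ∑ N (λ u → degree u * h u) ≡ ∑ M (λ j → ∇ h j * ∇ h j)
    ∑-degree-h≡∑-∇² = begin
      ∑ N (λ u → degree u * h u)             ≡⟨ ∑-cong N (λ {u} _ → ℚₚ.*-comm (degree u) (h u)) ⟩
      ∑ N (λ u → h u * degree u)             ≡⟨ ∑-degree h ⟩
      ∑ M (λ j → h (suc j) + h (p (suc j)))  ≡⟨ sym (green-identity h at-target) ⟩
      ∑ M (λ j → ∇ h j * ∇ h j)              ∎

    ∇-cut : ∀ {x} (χ : ℕ → ℚ) → x ℕ.< M → (∀ {j} → j ℕ.< M → ∇ χ j ≡ (if x ≡ᵇ j then 1ℚ else 0ℚ)) →
            χ v ≡ 0ℚ → ∇ h x ≡ ∑ M (λ j → χ (suc j) + χ (p (suc j)))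
    ∇-cut {x} χ x<M ∇χ≡δ χv = begin
      ∇ h x
        ≡⟨ sym (∑-δ x<M (∇ h)) ⟩
      ∑ M (λ j → if x ≡ᵇ j then ∇ h j else 0ℚ)
        ≡⟨ ∑-cong M (λ {j} j<M → trans (sym (if-* (x ≡ᵇ j) (∇ h j))) (cong (_* ∇ h j) (sym (∇χ≡δ j<M)))) ⟩
      ∑ M (λ j → ∇ χ j * ∇ h j)
        ≡⟨ green-identity χ χv ⟩
      ∑ M (λ j → χ (suc j) + χ (p (suc j))) ∎

    ∇-cut-away : ∀ {x χ} → IsCut x χ → x ℕ.< M → χ v ≡ 0 → ∇ h x ≡ fromℕ (volume χ)
    ∇-cut-away {χ = χ} cut x<M χv =
      trans (∇-cut (fromℕ ∘ χ) x<M (∇-fromℕ-cut cut) (cong fromℕ χv)) (∑-fromℕ-volume χ)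

    -- χ − 1 has the same gradient as χ and vanishes at v.
    ∇-cut-near : ∀ {x χ} → IsCut x χ → x ℕ.< M → χ v ≡ 1 → ∇ h x + fromℕ (M ℕ.* 2) ≡ fromℕ (volume χ)
    ∇-cut-near {x} {χ} cut x<M χv = begin
      ∇ h x + fromℕ (M ℕ.* 2)
        ≡⟨ cong₂ _+_ (∇-cut χ′ x<M ∇χ′≡δ χ′v) (sym (∑-fromℕ-const M 2)) ⟩
      ∑ M (λ j → χ′ (suc j) + χ′ (p (suc j))) + ∑ M (λ _ → fromℕ 2)
        ≡⟨ sym (∑-distrib-⊕ M (λ j → χ′ (suc j) + χ′ (p (suc j))) (λ _ → fromℕ 2)) ⟩
      ∑ M (λ j → (χ′ (suc j) + χ′ (p (suc j))) + fromℕ 2)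
        ≡⟨ ∑-cong M (λ {j} _ → unshift (fromℕ (χ (suc j))) (fromℕ (χ (p (suc j))))) ⟩
      ∑ M (λ j → fromℕ (χ (suc j)) + fromℕ (χ (p (suc j))))
        ≡⟨ ∑-fromℕ-volume χ ⟩
      fromℕ (volume χ) ∎
      where
      χ′ : ℕ → ℚ
      χ′ i = fromℕ (χ i) - 1ℚ
      unshift : ∀ a b → ((a - 1ℚ) + (b - 1ℚ)) + (1ℚ + (1ℚ + 0ℚ)) ≡ a + b
      unshift = solve-∀ ℚ-ring
      sub-sub : ∀ a b → (a - 1ℚ) - (b - 1ℚ) ≡ a - b
      sub-sub = solve-∀ ℚ-ring
      ∇χ′≡δ : ∀ {j} → j ℕ.< M → ∇ χ′ j ≡ (if x ≡ᵇ j then 1ℚ else 0ℚ)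
      ∇χ′≡δ {j} j<M = trans (sub-sub (fromℕ (χ (suc j))) (fromℕ (χ (p (suc j))))) (∇-fromℕ-cut cut j<M)
      χ′v : χ′ v ≡ 0ℚ
      χ′v rewrite χv = cong (_- 1ℚ) (ℚₚ.+-identityʳ 1ℚ)

    ∇²-cut-away : ∀ {x χ m} → IsCut x χ → x ℕ.< M → ℕ-Sum.∑ M (χ ∘ suc) ≡ suc m → χ v ≡ 0 →
                  ∇ h x * ∇ h x ≡ fromℕ (odd² m)
    ∇²-cut-away {m = m} cut x<M size χv = trans (cong₂ _*_ ∇h≡ ∇h≡) (sym (fromℕ-* (suc (2 ℕ.* m)) (suc (2 ℕ.* m))))
      where
      ∇h≡ = trans (∇-cut-away cut x<M χv) (cong fromℕ (volume-cut cut x<M size))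

    ∇²-cut-near : ∀ {x χ m m′} → IsCut x χ → x ℕ.< M → ℕ-Sum.∑ M (χ ∘ suc) ≡ suc m → χ v ≡ 1 →
                  m′ ℕ.+ suc m ≡ M → ∇ h x * ∇ h x ≡ fromℕ (odd² m′)
    ∇²-cut-near {x} {χ} {m} {m′} cut x<M size χv m′+m+1≡M =
      trans (square-of-neg {∇ h x} {fromℕ (suc (2 ℕ.* m))} {fromℕ (suc (2 ℕ.* m′))} (begin
        ∇ h x + (fromℕ (suc (2 ℕ.* m)) + fromℕ (suc (2 ℕ.* m′)))
          ≡⟨ cong (∇ h x +_) (sym (fromℕ-+ (suc (2 ℕ.* m)) (suc (2 ℕ.* m′)))) ⟩
        ∇ h x + fromℕ (suc (2 ℕ.* m) ℕ.+ suc (2 ℕ.* m′))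
          ≡⟨ cong (λ n → ∇ h x + fromℕ n) (trans (edges-twice m m′) (cong (ℕ._* 2) m′+m+1≡M)) ⟩
        ∇ h x + fromℕ (M ℕ.* 2)
          ≡⟨ ∇-cut-near cut x<M χv ⟩
        fromℕ (volume χ)
          ≡⟨ cong fromℕ (volume-cut cut x<M size) ⟩
        fromℕ (suc (2 ℕ.* m)) ∎))
      (sym (fromℕ-* (suc (2 ℕ.* m′)) (suc (2 ℕ.* m′))))
      where
      edges-twice : ∀ a b → suc (2 ℕ.* a) ℕ.+ suc (2 ℕ.* b) ≡ (b ℕ.+ suc a) ℕ.* 2
      edges-twice = ℕ-Solver.solve-∀

    ∇²-leaf : ∀ {y} → y ℕ.< M → IsLeaf (suc y) →
              ∇ h y * ∇ h y ≡ fromℕ (odd² (if suc y ≡ᵇ v then M ∸ 1 else 0))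
    ∇²-leaf {y} y<M leaf with suc y ≡ᵇ v in leaf≡v
    ... | true  = ∇²-cut-near (leafCut-isCut leaf) y<M (leafCut-size y<M) (cong (if_then 1 else 0) leaf≡v)
                              (ℕₚ.m∸n+n≡m (ℕₚ.≤-<-trans z≤n y<M))
    ... | false = ∇²-cut-away (leafCut-isCut leaf) y<M (leafCut-size y<M) (cong (if_then 1 else 0) leaf≡v)

  module _ (H : Fin N → Fin N → ℚ) (hit : IsHittingTime (treeAdj p) H) (v : Fin N) where

    private
      h : ℕ → ℚ
      h = lift (λ x → H x v)

      h≡H : ∀ x → h (toℕ x) ≡ H x v
      h≡H = lift-toℕ (λ x → H x v)

      deg≡degree : ∀ x → deg (treeAdj p) x ≡ degree (toℕ x)
      deg≡degree x = Σℚ≡∑ {N} (λ w → if treeAdj p x w then 1ℚ else 0ℚ) (λ w → if adj (toℕ x) w then 1ℚ else 0ℚ)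
                          (λ _ → refl)

      neighbours≡nbSum : ∀ x → Σℚ (λ w → if treeAdj p x w then H w v else 0ℚ) ≡ nbSum h (toℕ x)
      neighbours≡nbSum x = Σℚ≡∑ {N} (λ w → if treeAdj p x w then H w v else 0ℚ) (λ w → if adj (toℕ x) w then h w else 0ℚ)
        (λ w → cong (if adj (toℕ x) (toℕ w) then_else 0ℚ) (sym (h≡H w)))

      first-step-Fin : ∀ x → x ≢ v → degree (toℕ x) * h (toℕ x) ≡ degree (toℕ x) + nbSum h (toℕ x)
      first-step-Fin x x≢v = begin
        degree (toℕ x) * h (toℕ x)
          ≡⟨ cong₂ _*_ (sym (deg≡degree x)) (h≡H x) ⟩
        deg (treeAdj p) x * H x v
          ≡⟨ proj₂ hit x v x≢v ⟩
        deg (treeAdj p) x + Σℚ (λ w → if treeAdj p x w then H w v else 0ℚ)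
          ≡⟨ cong₂ _+_ (deg≡degree x) (neighbours≡nbSum x) ⟩
        degree (toℕ x) + nbSum h (toℕ x) ∎

    hittingEqs : HittingEqs h (toℕ v)
    hittingEqs = record
      { at-target  = trans (h≡H v) (proj₁ hit v)
      ; first-step = λ {u} u<N u≢v →
          subst (λ i → degree i * h i ≡ degree i + nbSum h i) (Finₚ.toℕ-fromℕ< u<N)
                (first-step-Fin (Fin.fromℕ< u<N) (u≢v ∘ trans (sym (Finₚ.toℕ-fromℕ< u<N)) ∘ cong toℕ))
      }

    J-tree : (m : ℕ → ℕ) →
             (∀ {h} → HittingEqs h (toℕ v) → ∀ {j} → j ℕ.< M → ∇ h j * ∇ h j ≡ fromℕ (odd² (m j))) →
             J (treeAdj p) H v ≡ fromℕ (ℕ-Sum.∑ M (odd² ∘ m))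
    J-tree m ∇²≡ = begin
      J (treeAdj p) H v
        ≡⟨ Σℚ≡∑ {N} (λ x → deg (treeAdj p) x * H x v) (λ u → degree u * h u)
                (λ x → cong₂ _*_ (deg≡degree x) (sym (h≡H x))) ⟩
      ∑ N (λ u → degree u * h u)
        ≡⟨ Hitting.∑-degree-h≡∑-∇² hittingEqs ⟩
      ∑ M (λ j → ∇ h j * ∇ h j)
        ≡⟨ ∑-cong M (∇²≡ hittingEqs) ⟩
      ∑ M (λ j → fromℕ (odd² (m j)))
        ≡⟨ sym (fromℕ-∑ M (odd² ∘ m)) ⟩
      fromℕ (ℕ-Sum.∑ M (odd² ∘ m)) ∎

odd²-mono-≤ : ∀ {m n} → m ≤ n → odd² m ≤ odd² n
odd²-mono-≤ m≤n = ℕₚ.*-mono-≤ odd≤ odd≤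
  where odd≤ = s≤s (ℕₚ.*-monoʳ-≤ 2 m≤n)

odd²-mono-< : ∀ {m n} → m ℕ.< n → odd² m ℕ.< odd² n
odd²-mono-< m<n = ℕₚ.*-mono-< odd< odd<
  where odd< = s≤s (ℕₚ.*-monoʳ-< 2 m<n)

<ᵇ-suc : ∀ x j → (if x <ᵇ suc j then 1 else 0) ≡ (if x ≡ᵇ j then 1 else 0) ℕ.+ (if x <ᵇ j then 1 else 0)
<ᵇ-suc zero    zero    = refl
<ᵇ-suc zero    (suc j) = refl
<ᵇ-suc (suc x) zero    = refl
<ᵇ-suc (suc x) (suc j) = <ᵇ-suc x j

-- Double brooms

module DoubleBroom (q L R : ℕ) where

  M : ℕ
  M = q ℕ.+ L ℕ.+ R

  p : ℕ → ℕ
  p = dbParent (2 ℕ.+ q) L R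

  data Label (i : ℕ) : Set where
    path      : i ≤ q → Label i
    leftLeaf  : q ℕ.< i → i ℕ.< suc q ℕ.+ L → Label i
    rightLeaf : suc q ℕ.+ L ≤ i → Label i

  label : ∀ i → Label i
  label i with i ℕ.≤? q
  ... | yes i≤q = path i≤q
  ... | no  i≰q with i ℕ.<? suc q ℕ.+ L
  ...   | yes i<q+L+1 = leftLeaf (ℕₚ.≰⇒> i≰q) i<q+L+1
  ...   | no  i≮q+L+1 = rightLeaf (ℕₚ.≮⇒≥ i≮q+L+1)

  q<rightLeaf : ∀ {i} → suc q ℕ.+ L ≤ i → q ℕ.< i
  q<rightLeaf = ℕₚ.≤-trans (s≤s (ℕₚ.m≤m+n q L))

  parent-path : ∀ {i} → i ≤ q → p i ≡ i ∸ 1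
  parent-path i≤q rewrite ≤ᵇ-true i≤q = refl

  parent-leftLeaf : ∀ {i} → q ℕ.< i → i ℕ.< suc q ℕ.+ L → p i ≡ 0
  parent-leftLeaf q<i i<q+L+1 rewrite ≤ᵇ-false q<i | <ᵇ-true i<q+L+1 = refl

  parent-rightLeaf : ∀ {i} → suc q ℕ.+ L ≤ i → p i ≡ q
  parent-rightLeaf q+L+1≤i rewrite ≤ᵇ-false (q<rightLeaf q+L+1≤i) | <ᵇ-false q+L+1≤i = refl

  parent≤q : ∀ i → p i ≤ q
  parent≤q i with label i
  ... | path i≤q             rewrite parent-path i≤q             = ℕₚ.≤-trans (ℕₚ.m∸n≤m i 1) i≤q
  ... | leftLeaf q<i i<q+L+1 rewrite parent-leftLeaf q<i i<q+L+1 = z≤n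
  ... | rightLeaf q+L+1≤i    rewrite parent-rightLeaf q+L+1≤i    = ℕₚ.≤-refl

  parent≤ : ∀ {j} → j ℕ.< M → p (suc j) ≤ j
  parent≤ {j} _ with label (suc j)
  ... | path j<q              rewrite parent-path j<q              = ℕₚ.≤-refl
  ... | leftLeaf q<j+1 j<q+L  rewrite parent-leftLeaf q<j+1 j<q+L  = z≤n
  ... | rightLeaf q+L+1≤j+1   rewrite parent-rightLeaf q+L+1≤j+1   = ℕₚ.≤-pred (q<rightLeaf q+L+1≤j+1)

  open Tree M p parent≤ public

  -- Whether path edge x, which joins the labels x and x + 1, separates i from the root v₁.
  beyond : ℕ → ℕ → Bool
  beyond x i = if i ≤ᵇ q then x <ᵇ i else not (i <ᵇ suc q ℕ.+ L)

  beyond-path : ∀ {x i} → i ≤ q → beyond x i ≡ (x <ᵇ i)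
  beyond-path i≤q rewrite ≤ᵇ-true i≤q = refl

  beyond-leftLeaf : ∀ {x i} → q ℕ.< i → i ℕ.< suc q ℕ.+ L → beyond x i ≡ false
  beyond-leftLeaf q<i i<q+L+1 rewrite ≤ᵇ-false q<i | <ᵇ-true i<q+L+1 = refl

  beyond-rightLeaf : ∀ {x i} → suc q ℕ.+ L ≤ i → beyond x i ≡ true
  beyond-rightLeaf q+L+1≤i rewrite ≤ᵇ-false (q<rightLeaf q+L+1≤i) | <ᵇ-false q+L+1≤i = refl

  pathCut : ℕ → ℕ → ℕ
  pathCut x i = if beyond x i then 1 else 0

  pathCut-isCut : ∀ {x} → x ℕ.< q → IsCut x (pathCut x)
  pathCut-isCut {x} x<q = isCut jump
    where
    x≢ : ∀ {j} → q ℕ.< suc j → x ≢ j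
    x≢ q<x+1 refl = ℕₚ.<⇒≱ x<q (ℕₚ.≤-pred q<x+1)
    jump : ∀ {j} → j ℕ.< M → pathCut x (suc j) ≡ (if x ≡ᵇ j then 1 else 0) ℕ.+ pathCut x (p (suc j))
    jump {j} _ with label (suc j)
    ... | path j<q
          rewrite beyond-path {x} j<q | parent-path j<q | beyond-path {x} (ℕₚ.<⇒≤ j<q) = <ᵇ-suc x j
    ... | leftLeaf q<j+1 j<q+L
          rewrite beyond-leftLeaf {x} q<j+1 j<q+L | parent-leftLeaf q<j+1 j<q+L | ≡ᵇ-false (x≢ q<j+1) = refl
    ... | rightLeaf q+L+1≤j+1
          rewrite beyond-rightLeaf {x} q+L+1≤j+1 | parent-rightLeaf q+L+1≤j+1
                | beyond-path {x} (ℕₚ.≤-refl {q}) | <ᵇ-true x<q | ≡ᵇ-false (x≢ (q<rightLeaf q+L+1≤j+1)) = refl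

  pathCut-size : ∀ {x} → x ℕ.< q → ℕ-Sum.∑ M (pathCut x ∘ suc) ≡ suc (q ∸ suc x ℕ.+ R)
  pathCut-size {x} x<q = begin
    ∑ M (pathCut x ∘ suc)
      ≡⟨ ∑-++ (q ℕ.+ L) R (pathCut x ∘ suc) ⟩
    ∑ (q ℕ.+ L) (pathCut x ∘ suc) ℕ.+ ∑ R (λ i → pathCut x (suc (q ℕ.+ L ℕ.+ i)))
      ≡⟨ cong (ℕ._+ ∑ R (λ i → pathCut x (suc (q ℕ.+ L ℕ.+ i)))) (∑-++ q L (pathCut x ∘ suc)) ⟩
    (∑ q (pathCut x ∘ suc) ℕ.+ ∑ L (λ i → pathCut x (suc (q ℕ.+ i)))) ℕ.+ ∑ R (λ i → pathCut x (suc (q ℕ.+ L ℕ.+ i)))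
      ≡⟨ cong₂ ℕ._+_ (cong₂ ℕ._+_ pathPart leftPart) rightPart ⟩
    (q ∸ x ℕ.+ 0) ℕ.+ R
      ≡⟨ cong (ℕ._+ R) (trans (ℕₚ.+-identityʳ (q ∸ x)) (ℕₚ.+-∸-assoc 1 x<q)) ⟩
    suc (q ∸ suc x ℕ.+ R) ∎
    where
    open ℕ-Sum
    open ≡-Reasoning
    pathPart : ∑ q (pathCut x ∘ suc) ≡ q ∸ x
    pathPart = trans (∑-cong q (λ j<q → cong (if_then 1 else 0) (beyond-path {x} j<q))) (∑-count q x)
    leftPart : ∑ L (λ i → pathCut x (suc (q ℕ.+ i))) ≡ 0
    leftPart = trans (∑-cong L (λ {i} i<L → cong (if_then 1 else 0)
                       (beyond-leftLeaf {x} (s≤s (ℕₚ.m≤m+n q i)) (s≤s (ℕₚ.+-monoʳ-< q i<L)))))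
                     (∑-zero L)
    rightPart : ∑ R (λ i → pathCut x (suc (q ℕ.+ L ℕ.+ i))) ≡ R
    rightPart = trans (∑-cong R (λ {i} _ → cong (if_then 1 else 0) (beyond-rightLeaf {x} (s≤s (ℕₚ.m≤m+n (q ℕ.+ L) i)))))
                      (trans (∑-const R 1) (ℕₚ.*-identityʳ R))

  -- The number of edges on the side of edge j that does not contain v.
  farEdges : ℕ → ℕ → ℕ
  farEdges v j = if suc j ≤ᵇ q then (if beyond j v then j ℕ.+ L else q ∸ suc j ℕ.+ R)
                 else (if suc j ≡ᵇ v then M ∸ 1 else 0)

  isLeaf : ∀ {i} → q ℕ.< i → IsLeaf i
  isLeaf q<i {j} _ p[j+1]≡i = ℕₚ.<⇒≱ q<i (subst (_≤ q) p[j+1]≡i (parent≤q (suc j)))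

  farEdges-path : ∀ {v j} → suc j ≤ q → farEdges v j ≡ (if beyond j v then j ℕ.+ L else q ∸ suc j ℕ.+ R)
  farEdges-path j<q rewrite ≤ᵇ-true j<q = refl

  farEdges-leaf : ∀ {v j} → q ℕ.< suc j → farEdges v j ≡ (if suc j ≡ᵇ v then M ∸ 1 else 0)
  farEdges-leaf q<j+1 rewrite ≤ᵇ-false q<j+1 = refl

  module _ {h v} (eqs : HittingEqs h v) where
    open Hitting eqs

    ∇²-pathEdge : ∀ {j} → j ℕ.< M → suc j ≤ q →
                  ∇ h j * ∇ h j ≡ fromℕ (odd² (if beyond j v then j ℕ.+ L else q ∸ suc j ℕ.+ R))
    ∇²-pathEdge {j} j<M j<q with beyond j v in beyond≡
    ... | true  = ∇²-cut-near (pathCut-isCut j<q) j<M (pathCut-size j<q) (cong (if_then 1 else 0) beyond≡)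
                              edges-on-both-sides
      where
      rearrange : ∀ a b c d → (a ℕ.+ b) ℕ.+ suc (c ℕ.+ d) ≡ suc a ℕ.+ c ℕ.+ b ℕ.+ d
      rearrange = ℕ-Solver.solve-∀
      edges-on-both-sides : (j ℕ.+ L) ℕ.+ suc (q ∸ suc j ℕ.+ R) ≡ M
      edges-on-both-sides =
        trans (rearrange j L (q ∸ suc j) R) (cong (λ n → n ℕ.+ L ℕ.+ R) (ℕₚ.m+[n∸m]≡n j<q))
    ... | false = ∇²-cut-away (pathCut-isCut j<q) j<M (pathCut-size j<q) (cong (if_then 1 else 0) beyond≡)

    ∇²-farEdges : ∀ {j} → j ℕ.< M → ∇ h j * ∇ h j ≡ fromℕ (odd² (farEdges v j))
    ∇²-farEdges {j} j<M with suc j ℕ.≤? q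
    ... | yes j<q = trans (∇²-pathEdge j<M j<q) (cong (fromℕ ∘ odd²) (sym (farEdges-path {v} j<q)))
    ... | no  j≮q = trans (∇²-leaf j<M (isLeaf (ℕₚ.≰⇒> j≮q))) (cong (fromℕ ∘ odd²) (sym (farEdges-leaf {v} (ℕₚ.≰⇒> j≮q))))

  J-farEdges : ∀ H → IsHittingTime (dbAdj (2 ℕ.+ q) L R) H → ∀ v →
               J (dbAdj (2 ℕ.+ q) L R) H v ≡ fromℕ (ℕ-Sum.∑ M (odd² ∘ farEdges (toℕ v)))
  J-farEdges H hit v = J-tree H hit v (farEdges (toℕ v)) ∇²-farEdges

  -- Far-side edge counts of the path edges, seen from a vertex lying beyond exactly the first ι of them.
  pathFar : ℕ → ℕ → ℕ
  pathFar ι j = if j <ᵇ ι then j ℕ.+ L else q ∸ suc j ℕ.+ R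

  pathPosition : ∀ v → Σ[ ι ∈ ℕ ] (ι ≤ q × (∀ {j} → j ℕ.< q → beyond j v ≡ (j <ᵇ ι)))
  pathPosition v with label v
  ... | path v≤q             = v , v≤q , λ _ → beyond-path v≤q
  ... | leftLeaf q<v v<q+L+1 = 0 , z≤n , λ _ → beyond-leftLeaf q<v v<q+L+1
  ... | rightLeaf q+L+1≤v    = q , ℕₚ.≤-refl , λ j<q → trans (beyond-rightLeaf q+L+1≤v) (sym (<ᵇ-true j<q))

  -- Pair edge j < ι with edge ι − 1 − j; L ≤ R makes every pair comparable.
  ∑-pathFar-≤ : L ≤ R → ∀ {ι} → ι ≤ q → ℕ-Sum.∑ q (odd² ∘ pathFar ι) ≤ ℕ-Sum.∑ q (odd² ∘ pathFar 0)
  ∑-pathFar-≤ L≤R {ι} ι≤q = begin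
    ∑ q (odd² ∘ pathFar ι)
      ≡⟨ ∑-split ι≤q (odd² ∘ pathFar ι) ⟩
    ∑ ι (odd² ∘ pathFar ι) ℕ.+ ∑ (q ∸ ι) (λ i → odd² (pathFar ι (ι ℕ.+ i)))
      ≡⟨ cong₂ ℕ._+_ (∑-cong ι (λ {j} j<ι → cong (λ b → odd² (if b then j ℕ.+ L else q ∸ suc j ℕ.+ R))
                                                   (<ᵇ-true j<ι)))
                     (∑-cong (q ∸ ι) (λ {i} _ → cong (λ b → odd² (if b then ι ℕ.+ i ℕ.+ L else q ∸ suc (ι ℕ.+ i) ℕ.+ R))
                                                   (<ᵇ-false (ℕₚ.m≤m+n ι i)))) ⟩
    ∑ ι near ℕ.+ ∑ (q ∸ ι) (λ i → far (ι ℕ.+ i))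
      ≡⟨ cong (ℕ._+ ∑ (q ∸ ι) (λ i → far (ι ℕ.+ i))) (sym (∑-reverse ι near)) ⟩
    ∑ ι (λ j → near (ι ∸ suc j)) ℕ.+ ∑ (q ∸ ι) (λ i → far (ι ℕ.+ i))
      ≤⟨ ℕₚ.+-monoˡ-≤ _ (∑-mono-≤ ι (λ {j} _ → odd²-mono-≤ (ℕₚ.+-mono-≤ (ℕₚ.∸-monoˡ-≤ (suc j) ι≤q) L≤R))) ⟩
    ∑ ι far ℕ.+ ∑ (q ∸ ι) (λ i → far (ι ℕ.+ i))
      ≡⟨ sym (∑-split ι≤q far) ⟩
    ∑ q far ∎
    where
    open ℕ-Sum
    open ℕₚ.≤-Reasoning
    near far : ℕ → ℕ
    near j = odd² (j ℕ.+ L)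
    far  j = odd² (q ∸ suc j ℕ.+ R)

  ∑-split-path : ∀ (f : ℕ → ℕ) → ℕ-Sum.∑ M f ≡ ℕ-Sum.∑ q f ℕ.+ ℕ-Sum.∑ (L ℕ.+ R) (λ i → f (q ℕ.+ i))
  ∑-split-path f = trans (cong (λ n → ℕ-Sum.∑ n f) (ℕₚ.+-assoc q L R)) (ℕ-Sum.∑-++ q (L ℕ.+ R) f)

  ∑-leafEdges : ∀ v → ℕ-Sum.∑ (L ℕ.+ R) (λ i → odd² (farEdges v (q ℕ.+ i))) ≡
                ℕ-Sum.∑ (L ℕ.+ R) (λ i → if suc q ℕ.+ i ≡ᵇ v then odd² (M ∸ 1) else 1)
  ∑-leafEdges v = ℕ-Sum.∑-cong (L ℕ.+ R) (λ {i} _ →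
    trans (cong odd² (farEdges-leaf {v} (s≤s (ℕₚ.m≤m+n q i)))) (Boolₚ.if-float odd² (suc q ℕ.+ i ≡ᵇ v)))

  ∑-pathEdges-firstLeftLeaf : 1 ≤ L → ℕ-Sum.∑ q (odd² ∘ farEdges (suc q)) ≡ ℕ-Sum.∑ q (odd² ∘ pathFar 0)
  ∑-pathEdges-firstLeftLeaf 1≤L = ℕ-Sum.∑-cong q (λ {j} j<q →
    cong odd² (trans (farEdges-path {suc q} j<q)
                     (cong (if_then j ℕ.+ L else q ∸ suc j ℕ.+ R)
                           (beyond-leftLeaf {j} ℕₚ.≤-refl (s≤s (ℕₚ.m<m+n q 1≤L))))))

  ∑-farEdges-≤-firstLeftLeaf : 1 ≤ L → L ≤ R → ∀ v →
                               ℕ-Sum.∑ M (odd² ∘ farEdges v) ≤ ℕ-Sum.∑ M (odd² ∘ farEdges (suc q))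
  ∑-farEdges-≤-firstLeftLeaf 1≤L L≤R v with pathPosition v
  ... | ι , ι≤q , beyond≡ = begin
    ∑ M (odd² ∘ farEdges v)
      ≡⟨ ∑-split-path (odd² ∘ farEdges v) ⟩
    ∑ q (odd² ∘ farEdges v) ℕ.+ ∑ (L ℕ.+ R) (λ i → odd² (farEdges v (q ℕ.+ i)))
      ≡⟨ cong₂ ℕ._+_ (∑-cong q (λ {j} j<q → cong odd² (trans (farEdges-path {v} j<q)
                        (cong (if_then j ℕ.+ L else q ∸ suc j ℕ.+ R) (beyond≡ j<q)))))
                     (∑-leafEdges v) ⟩
    ∑ q (odd² ∘ pathFar ι) ℕ.+ ∑ (L ℕ.+ R) (λ i → if suc q ℕ.+ i ≡ᵇ v then odd² (M ∸ 1) else 1)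
      ≤⟨ ℕₚ.+-mono-≤ (∑-pathFar-≤ L≤R ι≤q) (∑-spike-≤ (L ℕ.+ R) (suc q) v y) ⟩
    ∑ q (odd² ∘ pathFar 0) ℕ.+ (y ℕ.+ (L ℕ.+ R))
      ≡⟨ cong₂ ℕ._+_ (sym (∑-pathEdges-firstLeftLeaf 1≤L))
                     (sym (trans (∑-leafEdges (suc q))
                                 (∑-spike-at (L ℕ.+ R) {suc q} y (ℕₚ.≤-trans 1≤L (ℕₚ.m≤m+n L R)) refl))) ⟩
    ∑ q (odd² ∘ farEdges (suc q)) ℕ.+ ∑ (L ℕ.+ R) (λ i → odd² (farEdges (suc q) (q ℕ.+ i)))
      ≡⟨ sym (∑-split-path (odd² ∘ farEdges (suc q))) ⟩
    ∑ M (odd² ∘ farEdges (suc q)) ∎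
    where
    open ℕ-Sum
    open ℕₚ.≤-Reasoning
    y : ℕ
    y = ℕ.pred (odd² (M ∸ 1))

-- Near double brooms

module NearDoubleBroom (q ℓ r k : ℕ) (k≤q : k ≤ q) (1≤ℓ : 1 ≤ ℓ) where

  module D = DoubleBroom q ℓ r

  M : ℕ
  M = D.M ℕ.+ 1

  z : ℕ
  z = suc D.M

  p : ℕ → ℕ
  p = ndbParent (2 ℕ.+ q) ℓ r k

  q<z : q ℕ.< z
  q<z = s≤s (ℕₚ.≤-trans (ℕₚ.m≤m+n q ℓ) (ℕₚ.m≤m+n (q ℕ.+ ℓ) r))

  ≤q⇒≢z : ∀ {i} → i ≤ q → i ≢ z
  ≤q⇒≢z i≤q refl = ℕₚ.<⇒≱ q<z i≤q

  parent-singleton : p z ≡ k ∸ 1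
  parent-singleton rewrite ≡ᵇ-true {z} refl = refl

  parent-old : ∀ {i} → i ≢ z → p i ≡ D.p i
  parent-old i≢z rewrite ≡ᵇ-false i≢z = refl

  k-1≤q : k ∸ 1 ≤ q
  k-1≤q = ℕₚ.≤-trans (ℕₚ.m∸n≤m k 1) k≤q

  parent≤q : ∀ i → p i ≤ q
  parent≤q i with i ℕ.≟ z
  ... | yes refl = subst (_≤ q) (sym parent-singleton) k-1≤q
  ... | no  i≢z  = subst (_≤ q) (sym (parent-old i≢z)) (D.parent≤q i)

  below-singleton : ∀ {j} → j ℕ.< M → suc j ≢ z → j ℕ.< D.M
  below-singleton {j} j<M j+1≢z =
    ℕₚ.≤∧≢⇒< (ℕₚ.m<1+n⇒m≤n (subst (j ℕ.<_) (ℕₚ.+-comm D.M 1) j<M)) (j+1≢z ∘ cong suc)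

  parent≤ : ∀ {j} → j ℕ.< M → p (suc j) ≤ j
  parent≤ {j} j<M with suc j ℕ.≟ z
  ... | yes refl = ℕₚ.≤-trans (parent≤q z) (ℕₚ.≤-pred q<z)
  ... | no  j+1≢z rewrite parent-old j+1≢z = D.parent≤ (below-singleton j<M j+1≢z)

  open Tree M p parent≤ public

  -- The singleton leaf z lies beyond a path edge exactly when its neighbour v_k does.
  beyond : ℕ → ℕ → Bool
  beyond x i = if i ≡ᵇ z then D.beyond x (k ∸ 1) else D.beyond x i

  pathCut : ℕ → ℕ → ℕ
  pathCut x i = if beyond x i then 1 else 0

  pathCut-old : ∀ {x i} → i ≢ z → pathCut x i ≡ D.pathCut x i
  pathCut-old i≢z rewrite ≡ᵇ-false i≢z = refl

  pathCut-singleton : ∀ {x} → pathCut x z ≡ D.pathCut x (k ∸ 1)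
  pathCut-singleton rewrite ≡ᵇ-true {z} refl = refl

  pathCut-isCut : ∀ {x} → x ℕ.< q → IsCut x (pathCut x)
  pathCut-isCut {x} x<q = isCut jump
    where
    jump : ∀ {j} → j ℕ.< M → pathCut x (suc j) ≡ (if x ≡ᵇ j then 1 else 0) ℕ.+ pathCut x (p (suc j))
    jump {j} j<M with suc j ℕ.≟ z
    ... | yes refl
      rewrite pathCut-singleton {x} | parent-singleton | pathCut-old {x} (≤q⇒≢z k-1≤q)
            | ≡ᵇ-false {x} {D.M} (λ { refl → ℕₚ.<⇒≱ x<q (ℕₚ.≤-pred q<z) }) = refl
    ... | no j+1≢z
      rewrite pathCut-old {x} j+1≢z | parent-old j+1≢z | pathCut-old {x} (≤q⇒≢z (D.parent≤q (suc j))) =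
      D.IsCut.jump (D.pathCut-isCut x<q) (below-singleton j<M j+1≢z)

  singletonBeyond : ℕ → ℕ
  singletonBeyond x = D.pathCut x (k ∸ 1)

  pathCut-size : ∀ {x} → x ℕ.< q → ℕ-Sum.∑ M (pathCut x ∘ suc) ≡ suc (q ∸ suc x ℕ.+ r ℕ.+ singletonBeyond x)
  pathCut-size {x} x<q = begin
    ∑ M (pathCut x ∘ suc)
      ≡⟨ ∑-++ D.M 1 (pathCut x ∘ suc) ⟩
    ∑ D.M (pathCut x ∘ suc) ℕ.+ (pathCut x (suc (D.M ℕ.+ 0)) ℕ.+ 0)
      ≡⟨ cong₂ ℕ._+_ old singleton ⟩
    suc (q ∸ suc x ℕ.+ r) ℕ.+ singletonBeyond x ∎
    where
    open ℕ-Sum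
    open ≡-Reasoning
    old : ∑ D.M (pathCut x ∘ suc) ≡ suc (q ∸ suc x ℕ.+ r)
    old = trans (∑-cong D.M (λ j<M₀ → pathCut-old {x} (ℕₚ.<⇒≢ j<M₀ ∘ ℕₚ.suc-injective)))
                (D.pathCut-size x<q)
    singleton : pathCut x (suc (D.M ℕ.+ 0)) ℕ.+ 0 ≡ singletonBeyond x
    singleton = trans (ℕₚ.+-identityʳ _)
                      (trans (cong (λ n → pathCut x (suc n)) (ℕₚ.+-identityʳ D.M)) (pathCut-singleton {x}))

  firstLeftLeaf≢z : suc q ≢ z
  firstLeftLeaf≢z q+1≡z = ℕₚ.<⇒≢ (ℕₚ.≤-trans (ℕₚ.m<m+n q 1≤ℓ) (ℕₚ.m≤m+n (q ℕ.+ ℓ) r)) (ℕₚ.suc-injective q+1≡z)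

  pathCut-firstLeftLeaf : ∀ {x} → pathCut x (suc q) ≡ 0
  pathCut-firstLeftLeaf {x} = trans (pathCut-old {x} firstLeftLeaf≢z)
    (cong (if_then 1 else 0) (D.beyond-leftLeaf {x} ℕₚ.≤-refl (s≤s (ℕₚ.m<m+n q 1≤ℓ))))

  farEdges : ℕ → ℕ
  farEdges j = if suc j ≤ᵇ q then q ∸ suc j ℕ.+ r ℕ.+ singletonBeyond j
               else (if suc j ≡ᵇ suc q then M ∸ 1 else 0)

  farEdges-path : ∀ {j} → suc j ≤ q → farEdges j ≡ q ∸ suc j ℕ.+ r ℕ.+ singletonBeyond j
  farEdges-path j<q rewrite ≤ᵇ-true j<q = refl

  farEdges-leaf : ∀ {j} → q ℕ.< suc j → farEdges j ≡ (if suc j ≡ᵇ suc q then M ∸ 1 else 0)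
  farEdges-leaf q<j+1 rewrite ≤ᵇ-false q<j+1 = refl

  isLeaf : ∀ {i} → q ℕ.< i → IsLeaf i
  isLeaf q<i {j} _ p[j+1]≡i = ℕₚ.<⇒≱ q<i (subst (_≤ q) p[j+1]≡i (parent≤q (suc j)))

  ∇²-farEdges : ∀ {h} → HittingEqs h (suc q) → ∀ {j} → j ℕ.< M → ∇ h j * ∇ h j ≡ fromℕ (odd² (farEdges j))
  ∇²-farEdges eqs {j} j<M with suc j ℕ.≤? q
  ... | yes j<q = trans (Hitting.∇²-cut-away eqs (pathCut-isCut j<q) j<M (pathCut-size j<q) (pathCut-firstLeftLeaf {j}))
                        (cong (fromℕ ∘ odd²) (sym (farEdges-path j<q)))
  ... | no  j≮q = trans (Hitting.∇²-leaf eqs j<M (isLeaf (ℕₚ.≰⇒> j≮q)))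
                        (cong (fromℕ ∘ odd²) (sym (farEdges-leaf (ℕₚ.≰⇒> j≮q))))

  q+1<N : suc q ℕ.< N
  q+1<N = s≤s (ℕₚ.≤-trans q<z (ℕₚ.≤-reflexive (ℕₚ.+-comm 1 D.M)))

  firstLeftLeaf : Fin N
  firstLeftLeaf = Fin.fromℕ< q+1<N

  J-farEdges : ∀ H → IsHittingTime (ndbAdj (2 ℕ.+ q) ℓ r k) H →
               J (ndbAdj (2 ℕ.+ q) ℓ r k) H firstLeftLeaf ≡ fromℕ (ℕ-Sum.∑ M (odd² ∘ farEdges))
  J-farEdges H hit = J-tree H hit firstLeftLeaf farEdges
    (λ eqs → ∇²-farEdges (subst (HittingEqs _) (Finₚ.toℕ-fromℕ< q+1<N) eqs))

-- Moving the singleton leaf to v₁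

module MoveSingletonLeaf (q ℓ r k : ℕ) (2≤k : 2 ≤ k) (k≤q : k ≤ q) (1≤ℓ : 1 ≤ ℓ) where

  module G  = NearDoubleBroom q ℓ r k k≤q 1≤ℓ
  module G* = DoubleBroom q (suc ℓ) r

  M*≡M : G*.M ≡ G.M
  M*≡M = rearrange q ℓ r
    where
    rearrange : ∀ a b c → a ℕ.+ suc b ℕ.+ c ≡ a ℕ.+ b ℕ.+ c ℕ.+ 1
    rearrange = ℕ-Solver.solve-∀

  farEdges*-path : ∀ {j} → suc j ≤ q → G*.farEdges (suc q) j ≡ q ∸ suc j ℕ.+ r
  farEdges*-path {j} j<q = trans (G*.farEdges-path {suc q} j<q)
    (cong (if_then j ℕ.+ suc ℓ else q ∸ suc j ℕ.+ r)
          (G*.beyond-leftLeaf {j} ℕₚ.≤-refl (s≤s (ℕₚ.m<m+n q (s≤s z≤n)))))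

  farEdges-≤ : ∀ {j} → j ℕ.< G.M → G*.farEdges (suc q) j ≤ G.farEdges j
  farEdges-≤ {j} _ with suc j ℕ.≤? q
  ... | yes j<q = begin
    G*.farEdges (suc q) j                    ≡⟨ farEdges*-path j<q ⟩
    q ∸ suc j ℕ.+ r                          ≤⟨ ℕₚ.m≤m+n _ (G.singletonBeyond j) ⟩
    q ∸ suc j ℕ.+ r ℕ.+ G.singletonBeyond j  ≡⟨ sym (G.farEdges-path j<q) ⟩
    G.farEdges j                             ∎
    where open ℕₚ.≤-Reasoning
  ... | no  j≮q = ℕₚ.≤-reflexive (begin
    G*.farEdges (suc q) j                            ≡⟨ G*.farEdges-leaf {suc q} (ℕₚ.≰⇒> j≮q) ⟩
    (if suc j ≡ᵇ suc q then G*.M ∸ 1 else 0)         ≡⟨ cong (λ n → if suc j ≡ᵇ suc q then n ∸ 1 else 0) M*≡M ⟩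
    (if suc j ≡ᵇ suc q then G.M ∸ 1 else 0)          ≡⟨ sym (G.farEdges-leaf (ℕₚ.≰⇒> j≮q)) ⟩
    G.farEdges j                                     ∎)
    where open ≡-Reasoning

  -- Because k ≥ 2 the singleton leaf lies beyond the first path edge.
  farEdges-<-at-root : G*.farEdges (suc q) 0 ℕ.< G.farEdges 0
  farEdges-<-at-root = begin-strict
    G*.farEdges (suc q) 0                ≡⟨ farEdges*-path 1≤q ⟩
    q ∸ 1 ℕ.+ r                          <⟨ ℕₚ.m<m+n _ (ℕₚ.≤-reflexive (sym singletonBeyond≡1)) ⟩
    q ∸ 1 ℕ.+ r ℕ.+ G.singletonBeyond 0  ≡⟨ sym (G.farEdges-path 1≤q) ⟩
    G.farEdges 0                         ∎
    where
    open ℕₚ.≤-Reasoning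
    1≤q : 1 ≤ q
    1≤q = ℕₚ.≤-trans (ℕₚ.≤-trans (s≤s z≤n) 2≤k) k≤q
    singletonBeyond≡1 : G.singletonBeyond 0 ≡ 1
    singletonBeyond≡1 = cong (if_then 1 else 0)
      (trans (G.D.beyond-path {0} G.k-1≤q) (<ᵇ-true (ℕₚ.∸-monoˡ-≤ 1 2≤k)))

  ∑-farEdges-< : ℕ-Sum.∑ G*.M (odd² ∘ G*.farEdges (suc q)) ℕ.< ℕ-Sum.∑ G.M (odd² ∘ G.farEdges)
  ∑-farEdges-< =
    subst (λ n → ℕ-Sum.∑ n (odd² ∘ G*.farEdges (suc q)) ℕ.< ℕ-Sum.∑ G.M (odd² ∘ G.farEdges)) (sym M*≡M)
          (ℕ-Sum.∑-mono-< G.M (odd²-mono-≤ ∘ farEdges-≤) (ℕₚ.m≤n+m 1 G.D.M) (odd²-mono-< farEdges-<-at-root))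

lemma4p14 : (d ℓ r k : ℕ) → 4 ≤ d → 1 ≤ ℓ → ℓ ℕ.< r → 2 ≤ k → k ≤ d ∸ 2 →
    Σ[ ℓ' ∈ ℕ ] Σ[ r' ∈ ℕ ]
      (1 ≤ ℓ' × 1 ≤ r' × dbSize d ℓ' r' ≡ ndbSize d ℓ r ×
       (∀ H H* → IsHittingTime (ndbAdj d ℓ r k) H → IsHittingTime (dbAdj d ℓ' r') H* →
          maxJ (dbAdj d ℓ' r') H* < maxJ (ndbAdj d ℓ r k) H))
lemma4p14 (suc (suc q)) ℓ r k (s≤s (s≤s _)) 1≤ℓ ℓ<r 2≤k k≤q =
  suc ℓ , r , s≤s z≤n , ℕₚ.≤-trans (s≤s z≤n) ℓ<r , cong suc M*≡M , maxJ-<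
  where
  open MoveSingletonLeaf q ℓ r k 2≤k k≤q 1≤ℓ
  maxJ-< : ∀ H H* → IsHittingTime (ndbAdj (2 ℕ.+ q) ℓ r k) H → IsHittingTime (dbAdj (2 ℕ.+ q) (suc ℓ) r) H* →
           maxJ (dbAdj (2 ℕ.+ q) (suc ℓ) r) H* < maxJ (ndbAdj (2 ℕ.+ q) ℓ r k) H
  maxJ-< H H* hit hit* = begin-strict
    maxJ (dbAdj (2 ℕ.+ q) (suc ℓ) r) H*
      ≤⟨ maxℚ-least (J (dbAdj (2 ℕ.+ q) (suc ℓ) r) H*) (λ v →
           ℚₚ.≤-trans (ℚₚ.≤-reflexive (G*.J-farEdges H* hit* v))
                      (fromℕ-mono-≤ (G*.∑-farEdges-≤-firstLeftLeaf (s≤s z≤n) ℓ<r (toℕ v)))) ⟩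
    fromℕ (ℕ-Sum.∑ G*.M (odd² ∘ G*.farEdges (suc q)))
      <⟨ fromℕ-mono-< ∑-farEdges-< ⟩
    fromℕ (ℕ-Sum.∑ G.M (odd² ∘ G.farEdges))
      ≡⟨ sym (G.J-farEdges H hit) ⟩
    J (ndbAdj (2 ℕ.+ q) ℓ r k) H G.firstLeftLeaf
      ≤⟨ maxℚ-upper (J (ndbAdj (2 ℕ.+ q) ℓ r k) H) G.firstLeftLeaf ⟩
    maxJ (ndbAdj (2 ℕ.+ q) ℓ r k) H ∎
    where open ℚₚ.≤-Reasoning
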